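{- Let $m\ge1$, let $G(m,k)$ be the set of $k$-dimensional linear subspaces of $\mathbb{F}_2^{\,m}$, and let $h_m=\mathrm{cwe}(H_8\otimes_{\mathbb{F}_2}\mathbb{F}_{2^m})$. Then $$h_m=\sum_{v\in\mathbb{F}_2^{\,m}}x_v^8+14\sum_{U\in G(m,1)}\sum_{d\in\mathbb{F}_2^{\,m}/U}\prod_{v\in d+U}x_v^4+168\sum_{U\in G(m,2)}\sum_{d\in\mathbb{F}_2^{\,m}/U}\prod_{v\in d+U}x_v^2+1344\sum_{U\in G(m,3)}\sum_{d\in\mathbb{F}_2^{\,m}/U}\prod_{v\in d+U}x_v,$$ where $d$ runs over the cosets of $U$ in $\mathbb{F}_2^{\,m}$.
   Context: $H_8$ is the $[8,4,4]$ binary Hamming code, with generator matrix having rows $00001111$, $00110011$, $01010101$, $11111111$. Fix an $\mathbb{F}_2$-basis $a_1,\dots,a_m$ of $\mathbb{F}_{2^m}$ and identify $f=\sum\varepsilon_ia_i$ with $v=(\varepsilon_1,\dots,\varepsilon_m)\in\mathbb{F}_2^{\,m}$, writing $x_v=x_f$. For a binary linear code $C\subseteq\mathbb{F}_2^N$, $C\otimes_{\mathbb{F}_2}\mathbb{F}_{2^m}$ is its $\mathbb{F}_{2^m}$-span in $\mathbb{F}_{2^m}^N$, and its complete weight enumerator is $\sum_{c}\prod_fx_f^{a_f(c)}$, $a_f(c)$ being the number of coordinates of $c$ equal to $f$. -}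

module Defs where

open import Data.Bool using (Bool; true; false; if_then_else_; _∧_; _∨_; not; _xor_)
open import Data.Nat using (ℕ; zero; suc; _≡ᵇ_)
open import Data.List using (List; []; _∷_; map; concatMap; _++_; concat; replicate)
open import Data.Bool.ListAction using (all; any)
open import Data.Vec using (Vec; []; _∷_; zipWith; lookup)
import Data.Vec as V
open import Data.Fin using (Fin)

-- F₂ = Bool (addition = xor), F₂^m = Vec Bool m.
-- Via the fixed basis a₁..a_m, an element of F_{2^m} is identified
-- with its coordinate vector in Vec Bool m; field addition is xor.

_==ᵛ_ : ∀ {m} → Vec Bool m → Vec Bool m → Bool
[] ==ᵛ [] = true
(a ∷ u) ==ᵛ (b ∷ v) = not (a xor b) ∧ (u ==ᵛ v)

_⊕_ : ∀ {m} → Vec Bool m → Vec Bool m → Vec Bool m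
_⊕_ = zipWith _xor_

𝟎 : ∀ {m} → Vec Bool m
𝟎 = V.replicate _ false

allVecsOf : ∀ {A : Set} → List A → (k : ℕ) → List (Vec A k)
allVecsOf xs zero = [] ∷ []
allVecsOf xs (suc k) = concatMap (λ x → map (x ∷_) (allVecsOf xs k)) xs

allVecs : (m : ℕ) → List (Vec Bool m)
allVecs m = allVecsOf (false ∷ true ∷ []) m

filterᵇ : ∀ {A : Set} → (A → Bool) → List A → List A
filterᵇ p [] = []
filterᵇ p (x ∷ xs) = if p x then x ∷ filterᵇ p xs else filterᵇ p xs

-- subsets of F₂^m as characteristic functions; each subset listed once
Subset : ℕ → Set
Subset m = Vec Bool m → Bool

allSets : (m : ℕ) → List (Subset m)
allSets zero = (λ _ → false) ∷ (λ _ → true) ∷ []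
allSets (suc m) =
  concatMap (λ f → map (λ g → λ { (false ∷ v) → f v ; (true ∷ v) → g v })
                        (allSets m))
            (allSets m)

lincomb : ∀ {m k} → Vec Bool k → Vec (Vec Bool m) k → Vec Bool m
lincomb [] [] = 𝟎
lincomb (l ∷ ls) (b ∷ bs) = (if l then b else 𝟎) ⊕ lincomb ls bs

independent : ∀ {m k} → Vec (Vec Bool m) k → Bool
independent {m} {k} b =
  all (λ l → not (lincomb l b ==ᵛ 𝟎) ∨ (l ==ᵛ 𝟎)) (allVecs k)

inSpan : ∀ {m k} → Vec (Vec Bool m) k → Vec Bool m → Bool
inSpan {m} {k} b v = any (λ l → lincomb l b ==ᵛ v) (allVecs k)

isSubspaceDim : ∀ {m} → ℕ → Subset m → Bool
isSubspaceDim {m} k S =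
  any (λ b → independent b ∧ all (λ v → not (S v xor inSpan b v)) (allVecs m))
      (allVecsOf (allVecs m) k)

G : (m k : ℕ) → List (Subset m)
G m k = filterᵇ (isSubspaceDim k) (allSets m)

isCoset : ∀ {m} → Subset m → Subset m → Bool
isCoset {m} U D =
  any (λ d → all (λ v → not (D v xor U (v ⊕ d))) (allVecs m)) (allVecs m)

cosets : ∀ {m} → Subset m → List (Subset m)
cosets {m} U = filterᵇ (isCoset U) (allSets m)

-- Polynomials with ℕ-coefficients in the variables x_v (v ∈ F₂^m),
-- represented as formal sums (lists) of monomials; a monomial is its
-- exponent vector.

Monomial : ℕ → Set
Monomial m = Vec Bool m → ℕ

Poly : ℕ → Set
Poly m = List (Monomial m)

_==ᵐ_ : ∀ {m} → Monomial m → Monomial m → Bool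
_==ᵐ_ {m} μ ν = all (λ v → μ v ≡ᵇ ν v) (allVecs m)

count : ∀ {A : Set} → (A → Bool) → List A → ℕ
count p [] = 0
count p (x ∷ xs) = if p x then suc (count p xs) else count p xs

coeff : ∀ {m} → Monomial m → Poly m → ℕ
coeff e P = count (_==ᵐ e) P

_·ₚ_ : ∀ {m} → ℕ → Poly m → Poly m
n ·ₚ P = concat (replicate n P)

gen : Vec (Vec Bool 8) 4
gen = (false ∷ false ∷ false ∷ false ∷ true ∷ true ∷ true ∷ true ∷ [])
    ∷ (false ∷ false ∷ true ∷ true ∷ false ∷ false ∷ true ∷ true ∷ [])
    ∷ (false ∷ true ∷ false ∷ true ∷ false ∷ true ∷ false ∷ true ∷ [])
    ∷ (true ∷ true ∷ true ∷ true ∷ true ∷ true ∷ true ∷ true ∷ [])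
    ∷ []

Word : ℕ → Set
Word m = Vec (Vec Bool m) 8

combo : ∀ {m} → Vec (Vec Bool m) 4 → Word m
combo {m} ls = V.tabulate (λ j → go ls gen j)
  where
  go : ∀ {r} → Vec (Vec Bool m) r → Vec (Vec Bool 8) r → Fin 8 → Vec Bool m
  go [] [] j = 𝟎
  go (l ∷ ls) (g ∷ gs) j = (if lookup g j then l else 𝟎) ⊕ go ls gs j

-- membership in H₈ ⊗ F_{2^m} (the F_{2^m}-span of the rows of gen)
inCode : ∀ {m} → Word m → Bool
inCode {m} w =
  any (λ ls → V.foldr _ (λ b acc → b ∧ acc) true (zipWith _==ᵛ_ (combo ls) w))
      (allVecsOf (allVecs m) 4)

composition : ∀ {m} → Word m → Monomial m
composition w f = V.foldr _ (λ b n → if b then suc n else n) 0 (V.map (_==ᵛ f) w)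

cwe-H8 : (m : ℕ) → Poly m
cwe-H8 m = map composition (filterᵇ inCode (allVecsOf (allVecs m) 8))

xpow : ∀ {m} → Vec Bool m → ℕ → Monomial m
xpow v r w = if w ==ᵛ v then r else 0

cosetMonomial : ∀ {m} → ℕ → Subset m → Monomial m
cosetMonomial r D v = if D v then r else 0

cosetSum : (m k r : ℕ) → Poly m
cosetSum m k r = concatMap (λ U → map (cosetMonomial r) (cosets U)) (G m k)

rhs : (m : ℕ) → Poly m
rhs m = map (λ v → xpow v 8) (allVecs m)
     ++ (14 ·ₚ cosetSum m 1 4)
     ++ (168 ·ₚ cosetSum m 2 2)
     ++ (1344 ·ₚ cosetSum m 3 1)

-- The last row of the generator matrix is all ones, so the codeword with coefficients x₁, x₂, x₃, x₄ has
-- the entries x₄ + c₁x₁ + c₂x₂ + c₃x₃ (c ∈ F₂³): it lists the values of an affine map F₂³ → F_{2^m}.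
-- Choosing a basis of span(x₁, x₂, x₃), of dimension k ≤ 3, exhibits it as the image under an injective
-- affine map F₂^k → F_{2^m} of a codeword over F₂^k whose coefficients span F₂^k, and a finite check
-- shows that such a codeword takes every value of F₂^k exactly 2^(3-k) times. So every composition is
-- ∏_{v ∈ d+U} x_v^(2^(3-k)) for a k-dimensional coset d+U, and the codewords with this composition
-- correspond, via the affine map, to the codewords over F₂^k taking every value 2^(3-k) times; there are
-- 1, 14, 168 and 1344 of those. On the right-hand side such a monomial occurs exactly once, because its
-- support determines the coset d+U and the coset determines U.

module Submission where

open import Defs
open import Level using (0ℓ)
open import Algebra.Bundles using (AbelianGroup)
open import Algebra.Structures using (IsAbelianGroup)
import Algebra.Properties.AbelianGroup as AbelianGroupProperties
import Algebra.Properties.CommutativeSemigroup as CommutativeSemigroupProperties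
open import Data.Bool using (Bool; true; false; T; not; _∧_; _∨_; _xor_; if_then_else_)
open import Data.Bool.Properties as Bool
  using (T-∧; T-≡; ∧-zeroʳ; xor-assoc; xor-comm; xor-identityˡ; xor-identityʳ; xor-same)
open import Data.Bool.ListAction using (all; any)
open import Data.Empty using (⊥-elim)
open import Data.Fin using (Fin; zero; suc; #_)
open import Data.List using (List; []; _∷_; _++_; map; concatMap; concat; replicate)
open import Data.List.Membership.Propositional using (_∈_; lose)
open import Data.List.Relation.Unary.All as All using (All)
open import Data.List.Relation.Unary.All.Properties using (all⁺; all⁻)
open import Data.List.Relation.Unary.Any as Any using (Any; here; there)
open import Data.List.Relation.Unary.Any.Properties using (any⁺; any⁻; map⁻; concatMap⁻)
import Data.Nat as ℕ
open import Data.Nat using (ℕ; zero; suc; _+_; _*_; _≤_; z≤n; s≤s; _≡ᵇ_)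
open import Data.Nat.Properties using (+-commutativeSemigroup; *-identityʳ; ≡ᵇ⇒≡; ≡⇒≡ᵇ; m≤n⇒m≤1+n)
open import Data.Product using (Σ; ∃; _×_; _,_; proj₁; proj₂)
open import Data.Vec using (Vec; []; _∷_; lookup; _[_]%=_)
import Data.Vec as V
open import Data.Vec.Properties
  using (zipWith-assoc; zipWith-comm; zipWith-identityˡ; zipWith-identityʳ; lookup∘tabulate; ≡-dec; map-cong; map-∘)
open import Function using (_∘_; id; Equivalence)
open import Relation.Binary.Definitions using (DecidableEquality)
open import Relation.Binary.PropositionalEquality
open import Relation.Nullary using (¬_; Dec; yes; no; does; proof; _because_)
open import Relation.Nullary.Decidable using (decidable-stable)
open import Relation.Nullary.Reflects
  using (Reflects; ofʸ; ofⁿ; fromEquivalence; det; T-reflects; _×-reflects_; _→-reflects_)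

private variable
  A B C : Set
  m k n r : ℕ

reflects-sound : {P : Set} {b : Bool} → Reflects P b → T b → P
reflects-sound (ofʸ p) _ = p

reflects-complete : {P : Set} {b : Bool} → Reflects P b → P → T b
reflects-complete (ofʸ _)  _ = _
reflects-complete (ofⁿ ¬p) p = ¬p p

reflects-⇔ : {P Q : Set} {a b : Bool} → Reflects P a → Reflects Q b → (P → Q) → (Q → P) → a ≡ b
reflects-⇔ rp rq p⇒q q⇒p =
  det rp (fromEquivalence (q⇒p ∘ reflects-sound rq) (reflects-complete rq ∘ p⇒q))

T-⇔⇒≡ : {a b : Bool} → (T a → T b) → (T b → T a) → a ≡ b
T-⇔⇒≡ {a} {b} = reflects-⇔ (T-reflects a) (T-reflects b)

xnor-reflects : (a b : Bool) → Reflects (a ≡ b) (not (a xor b))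
xnor-reflects a b = fromEquivalence (sound a b) (λ { refl → complete a })
  where
  sound : ∀ a b → T (not (a xor b)) → a ≡ b
  sound false false _ = refl
  sound true  true  _ = refl
  complete : ∀ a → T (not (a xor a))
  complete false = _
  complete true  = _

-- Counting over lists

∑ : (A → ℕ) → List A → ℕ
∑ f []       = 0
∑ f (x ∷ xs) = f x + ∑ f xs

∑-cong : {f g : A → ℕ} (xs : List A) → f ≗ g → ∑ f xs ≡ ∑ g xs
∑-cong []       f≗g = refl
∑-cong (x ∷ xs) f≗g = cong₂ _+_ (f≗g x) (∑-cong xs f≗g)

∑-zero : (xs : List A) → ∑ (λ _ → 0) xs ≡ 0
∑-zero []       = refl
∑-zero (x ∷ xs) = ∑-zero xs

∑-+ : (f g : A → ℕ) (xs : List A) → ∑ (λ x → f x + g x) xs ≡ ∑ f xs + ∑ g xs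
∑-+ f g []       = refl
∑-+ f g (x ∷ xs) = begin
  (f x + g x) + ∑ (λ x → f x + g x) xs  ≡⟨ cong ((f x + g x) +_) (∑-+ f g xs) ⟩
  (f x + g x) + (∑ f xs + ∑ g xs)       ≡⟨ +-interchange (f x) (g x) (∑ f xs) (∑ g xs) ⟩
  (f x + ∑ f xs) + (g x + ∑ g xs)       ∎
  where
  open ≡-Reasoning
  +-interchange : ∀ a b c d → (a + b) + (c + d) ≡ (a + c) + (b + d)
  +-interchange = CommutativeSemigroupProperties.interchange +-commutativeSemigroup

count-cong : {p q : A → Bool} (xs : List A) → p ≗ q → count p xs ≡ count q xs
count-cong []       p≗q = refl
count-cong {q = q} (x ∷ xs) p≗q rewrite p≗q x with q x
... | true  = cong suc (count-cong xs p≗q)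
... | false = count-cong xs p≗q

count-∷ : (p : A → Bool) (x : A) (xs : List A) →
          count p (x ∷ xs) ≡ (if p x then 1 else 0) + count p xs
count-∷ p x xs with p x
... | true  = refl
... | false = refl

∑-if : (p : A → Bool) (c : ℕ) (xs : List A) → ∑ (λ x → if p x then c else 0) xs ≡ count p xs * c
∑-if p c []       = refl
∑-if p c (x ∷ xs) with p x
... | true  = cong (c +_) (∑-if p c xs)
... | false = ∑-if p c xs

count≡∑ : (p : A → Bool) (xs : List A) → count p xs ≡ ∑ (λ x → if p x then 1 else 0) xs
count≡∑ p xs = sym (trans (∑-if p 1 xs) (*-identityʳ (count p xs)))

count-false : (xs : List A) → count (λ _ → false) xs ≡ 0
count-false []       = refl
count-false (x ∷ xs) = count-false xs

count-∧ˡ : (b : Bool) (p : A → Bool) (xs : List A) →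
           count (λ x → b ∧ p x) xs ≡ (if b then count p xs else 0)
count-∧ˡ true  p xs = refl
count-∧ˡ false p xs = count-false xs

count-++ : (p : A → Bool) (xs ys : List A) → count p (xs ++ ys) ≡ count p xs + count p ys
count-++ p []       ys = refl
count-++ p (x ∷ xs) ys with p x
... | true  = cong suc (count-++ p xs ys)
... | false = count-++ p xs ys

count-map : (p : B → Bool) (f : A → B) (xs : List A) → count p (map f xs) ≡ count (p ∘ f) xs
count-map p f []       = refl
count-map p f (x ∷ xs) with p (f x)
... | true  = cong suc (count-map p f xs)
... | false = count-map p f xs

count-concatMap : (p : B → Bool) (f : A → List B) (xs : List A) →
                  count p (concatMap f xs) ≡ ∑ (λ x → count p (f x)) xs
count-concatMap p f []       = refl
count-concatMap p f (x ∷ xs) =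
  trans (count-++ p (f x) (concatMap f xs)) (cong (count p (f x) +_) (count-concatMap p f xs))

count-filterᵇ : (p q : A → Bool) (xs : List A) → count p (filterᵇ q xs) ≡ count (λ x → q x ∧ p x) xs
count-filterᵇ p q []       = refl
count-filterᵇ p q (x ∷ xs) with q x
... | false = count-filterᵇ p q xs
... | true with p x
...   | true  = cong suc (count-filterᵇ p q xs)
...   | false = count-filterᵇ p q xs

count-concat-replicate : (p : A → Bool) (c : ℕ) (xs : List A) → count p (concat (replicate c xs)) ≡ c * count p xs
count-concat-replicate p zero    xs = refl
count-concat-replicate p (suc c) xs =
  trans (count-++ p xs (concat (replicate c xs))) (cong (count p xs +_) (count-concat-replicate p c xs))

count≢0⇒Any : (p : A → Bool) (xs : List A) → count p xs ≢ 0 → Any (T ∘ p) xs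
count≢0⇒Any p []       c≢0 = ⊥-elim (c≢0 refl)
count≢0⇒Any p (x ∷ xs) c≢0 with p x in px
... | true  = here (subst T (sym px) _)
... | false = there (count≢0⇒Any p xs c≢0)

Any-filterᵇ⁻ : {P : A → Set} (q : A → Bool) (xs : List A) →
               Any P (filterᵇ q xs) → Any (λ x → T (q x) × P x) xs
Any-filterᵇ⁻ q (x ∷ xs) p with q x in qx | p
... | true  | here px = here (subst T (sym qx) _ , px)
... | true  | there p′ = there (Any-filterᵇ⁻ q xs p′)
... | false | p′ = there (Any-filterᵇ⁻ q xs p′)

∑-count-swap : (P : A → B → Bool) (xs : List A) (ys : List B) →
               ∑ (λ x → count (P x) ys) xs ≡ ∑ (λ y → count (λ x → P x y) xs) ys
∑-count-swap P []       ys = sym (∑-zero ys)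
∑-count-swap P (x ∷ xs) ys = begin
  count (P x) ys + ∑ (λ x′ → count (P x′) ys) xs
    ≡⟨ cong₂ _+_ (count≡∑ (P x) ys) (∑-count-swap P xs ys) ⟩
  ∑ (λ y → if P x y then 1 else 0) ys + ∑ (λ y → count (λ x′ → P x′ y) xs) ys
    ≡⟨ sym (∑-+ _ _ ys) ⟩
  ∑ (λ y → (if P x y then 1 else 0) + count (λ x′ → P x′ y) xs) ys
    ≡⟨ ∑-cong ys (λ y → sym (count-∷ (λ x′ → P x′ y) x xs)) ⟩
  ∑ (λ y → count (λ x′ → P x′ y) (x ∷ xs)) ys
    ∎
  where open ≡-Reasoning

count-product : (h : A → B → C) (p : C → Bool) (q : A → Bool) (r : B → Bool) (xs : List A) (ys : List B) →
                (∀ x y → p (h x y) ≡ q x ∧ r y) →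
                count p (concatMap (λ x → map (h x) ys) xs) ≡ count q xs * count r ys
count-product h p q r xs ys split = begin
  count p (concatMap (λ x → map (h x) ys) xs)     ≡⟨ count-concatMap p _ xs ⟩
  ∑ (λ x → count p (map (h x) ys)) xs             ≡⟨ ∑-cong xs (λ x → count-map p (h x) ys) ⟩
  ∑ (λ x → count (p ∘ h x) ys) xs                 ≡⟨ ∑-cong xs (λ x → count-cong ys (split x)) ⟩
  ∑ (λ x → count (λ y → q x ∧ r y) ys) xs         ≡⟨ ∑-cong xs (λ x → count-∧ˡ (q x) r ys) ⟩
  ∑ (λ x → if q x then count r ys else 0) xs      ≡⟨ ∑-if q (count r ys) xs ⟩
  count q xs * count r ys                         ∎
  where open ≡-Reasoning

EnumeratesOnce : DecidableEquality A → List A → Set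
EnumeratesOnce _≟_ xs = ∀ a → count (λ x → does (a ≟ x)) xs ≡ 1

module _ (_≟_ : DecidableEquality A) where

  enumeratesOnce-∈ : {xs : List A} → EnumeratesOnce _≟_ xs → ∀ a → a ∈ xs
  enumeratesOnce-∈ {xs} once a = Any.map (λ {x} → reflects-sound (proof (a ≟ x)))
    (count≢0⇒Any (λ x → does (a ≟ x)) xs (λ c≡0 → 1≢0 (trans (sym (once a)) c≡0)))
    where
    1≢0 : 1 ≢ 0
    1≢0 ()

  allVecsOf-enumeratesOnce : {xs : List A} → EnumeratesOnce _≟_ xs →
                             ∀ n → EnumeratesOnce (≡-dec _≟_) (allVecsOf xs n)
  allVecsOf-enumeratesOnce once zero    []       = refl
  allVecsOf-enumeratesOnce {xs} once (suc n) (a ∷ as) =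
    trans (count-product V._∷_ _ (λ x → does (a ≟ x)) (λ v → does (≡-dec _≟_ as v)) xs (allVecsOf xs n)
                         (λ _ _ → refl))
          (cong₂ _*_ (once a) (allVecsOf-enumeratesOnce once n as))

module _ (_≟ᴬ_ : DecidableEquality A) (_≟ᴮ_ : DecidableEquality B) where

  count-reindex : (xs : List A) (ys : List B) → EnumeratesOnce _≟ᴬ_ xs → EnumeratesOnce _≟ᴮ_ ys →
                  (g : B → A) → (∀ {b b′} → g b ≡ g b′ → b ≡ b′) →
                  (q : A → Bool) → (∀ a → T (q a) → ∃ λ b → g b ≡ a) →
                  count q xs ≡ count (q ∘ g) ys
  count-reindex xs ys xs-once ys-once g g-injective q g-onto = begin
    count q xs                                                    ≡⟨ count≡∑ q xs ⟩
    ∑ (λ a → if q a then 1 else 0) xs                             ≡⟨ ∑-cong xs fibre ⟩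
    ∑ (λ a → count (λ b → q a ∧ does (g b ≟ᴬ a)) ys) xs           ≡⟨ ∑-count-swap _ xs ys ⟩
    ∑ (λ b → count (λ a → q a ∧ does (g b ≟ᴬ a)) xs) ys           ≡⟨ ∑-cong ys image ⟩
    ∑ (λ b → if q (g b) then 1 else 0) ys                         ≡⟨ count≡∑ (q ∘ g) ys ⟨
    count (q ∘ g) ys                                              ∎
    where
    open ≡-Reasoning
    fibre : ∀ a → (if q a then 1 else 0) ≡ count (λ b → q a ∧ does (g b ≟ᴬ a)) ys
    fibre a with q a in qa
    ... | false = sym (count-false ys)
    ... | true with g-onto a (subst T (sym qa) _)
    ...   | b₀ , refl = sym (trans (count-cong ys same-fibre) (ys-once b₀))
      where
      same-fibre : ∀ b → does (g b ≟ᴬ g b₀) ≡ does (b₀ ≟ᴮ b)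
      same-fibre b = reflects-⇔ (proof (g b ≟ᴬ g b₀)) (proof (b₀ ≟ᴮ b)) (sym ∘ g-injective) (cong g ∘ sym)
    image : ∀ b → count (λ a → q a ∧ does (g b ≟ᴬ a)) xs ≡ (if q (g b) then 1 else 0)
    image b = trans (count-cong xs only-g-b)
      (trans (count-∧ˡ (q (g b)) _ xs) (cong (λ c → if q (g b) then c else 0) (xs-once (g b))))
      where
      only-g-b : ∀ a → q a ∧ does (g b ≟ᴬ a) ≡ q (g b) ∧ does (g b ≟ᴬ a)
      only-g-b a with g b ≟ᴬ a
      ... | yes refl = refl
      ... | no _     = trans (∧-zeroʳ (q a)) (sym (∧-zeroʳ (q (g b))))

==ᵛ-sound : (u v : Vec Bool m) → T (u ==ᵛ v) → u ≡ v
==ᵛ-sound []          []          _ = refl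
==ᵛ-sound (false ∷ u) (false ∷ v) h = cong (false ∷_) (==ᵛ-sound u v h)
==ᵛ-sound (true ∷ u)  (true ∷ v)  h = cong (true ∷_) (==ᵛ-sound u v h)

==ᵛ-refl : (u : Vec Bool m) → T (u ==ᵛ u)
==ᵛ-refl []          = _
==ᵛ-refl (false ∷ u) = ==ᵛ-refl u
==ᵛ-refl (true ∷ u)  = ==ᵛ-refl u

==ᵛ-reflects : (u v : Vec Bool m) → Reflects (u ≡ v) (u ==ᵛ v)
==ᵛ-reflects u v = fromEquivalence (==ᵛ-sound u v) (λ { refl → ==ᵛ-refl u })

_≟ᵛ_ : DecidableEquality (Vec Bool m)
u ≟ᵛ v = (u ==ᵛ v) because ==ᵛ-reflects u v

allVecs-enumeratesOnce : (m : ℕ) → EnumeratesOnce _≟ᵛ_ (allVecs m)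
allVecs-enumeratesOnce m v =
  trans (count-cong (allVecs m) (λ u → reflects-⇔ (==ᵛ-reflects v u) (proof (≡-dec Bool._≟_ v u)) id id))
        (allVecsOf-enumeratesOnce Bool._≟_ bools-once m v)
  where
  bools-once : EnumeratesOnce Bool._≟_ (false ∷ true ∷ [])
  bools-once false = refl
  bools-once true  = refl

∈-allVecs : (v : Vec Bool m) → v ∈ allVecs m
∈-allVecs {m} = enumeratesOnce-∈ _≟ᵛ_ (allVecs-enumeratesOnce m)

tuples-enumeratesOnce : (m n : ℕ) → EnumeratesOnce (≡-dec _≟ᵛ_) (allVecsOf (allVecs m) n)
tuples-enumeratesOnce m = allVecsOf-enumeratesOnce _≟ᵛ_ (allVecs-enumeratesOnce m)

∈-tuples : (vs : Vec (Vec Bool m) n) → vs ∈ allVecsOf (allVecs m) n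
∈-tuples {m} {n} = enumeratesOnce-∈ (≡-dec _≟ᵛ_) (tuples-enumeratesOnce m n)

module _ {xs : List A} (complete : ∀ a → a ∈ xs) {P : A → Set} (p : A → Bool)
         (p-reflects : ∀ a → Reflects (P a) (p a)) where

  all-reflects : Reflects (∀ a → P a) (all p xs)
  all-reflects = fromEquivalence
    (λ h a → reflects-sound (p-reflects a) (All.lookup (all⁺ p xs h) (complete a)))
    (λ h → all⁻ p (All.universal (λ a → reflects-complete (p-reflects a) (h a)) xs))

  any-reflects : Reflects (∃ P) (any p xs)
  any-reflects = fromEquivalence
    (λ h → let a , pa = Any.satisfied (any⁻ p xs h) in a , reflects-sound (p-reflects a) pa)
    (λ { (a , Pa) → any⁺ p (lose (complete a) (reflects-complete (p-reflects a) Pa)) })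

==ᵐ-reflects : (μ ν : Monomial m) → Reflects (μ ≗ ν) (μ ==ᵐ ν)
==ᵐ-reflects μ ν =
  all-reflects ∈-allVecs _ (λ v → fromEquivalence (≡ᵇ⇒≡ (μ v) (ν v)) (≡⇒≡ᵇ (μ v) (ν v)))

_==ˢ_ : Subset m → Subset m → Bool
S ==ˢ U = all (λ v → does (S v Bool.≟ U v)) (allVecs _)

==ˢ-reflects : (S U : Subset m) → Reflects (S ≗ U) (S ==ˢ U)
==ˢ-reflects S U = all-reflects ∈-allVecs _ (λ v → proof (S v Bool.≟ U v))

allSets-unique : (m : ℕ) (S : Subset m) → count (S ==ˢ_) (allSets m) ≡ 1
allSets-unique zero    S with S []
... | false = refl
... | true  = refl
allSets-unique (suc m) S =
  trans (count-product _ (S ==ˢ_) (S₀ ==ˢ_) (S₁ ==ˢ_) (allSets m) (allSets m) split)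
        (cong₂ _*_ (allSets-unique m S₀) (allSets-unique m S₁))
  where
  S₀ S₁ : Subset m
  S₀ v = S (false ∷ v)
  S₁ v = S (true ∷ v)
  -- The hole is the anonymous merge of f and g in the definition of allSets.
  split : ∀ f g → (S ==ˢ _) ≡ (S₀ ==ˢ f) ∧ (S₁ ==ˢ g)
  split f g = reflects-⇔ (==ˢ-reflects S _) (==ˢ-reflects S₀ f ×-reflects ==ˢ-reflects S₁ g)
    (λ S≗ → (λ v → S≗ (false ∷ v)) , (λ v → S≗ (true ∷ v)))
    (λ { (S₀≗f , S₁≗g) (false ∷ v) → S₀≗f v ; (S₀≗f , S₁≗g) (true ∷ v) → S₁≗g v })

-- composition w f is entryCount (_==ᵛ f) w by definition.
entryCount : (A → Bool) → Vec A n → ℕ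
entryCount p w = V.foldr _ (λ b c → if b then suc c else c) 0 (V.map p w)

entryCount-cong : (p : A → Bool) (q : B → Bool) (w : Vec A n) (w′ : Vec B n) →
                  (∀ j → p (lookup w j) ≡ q (lookup w′ j)) → entryCount p w ≡ entryCount q w′
entryCount-cong p q []      []        p≗q = refl
entryCount-cong p q (x ∷ w) (x′ ∷ w′) p≗q rewrite p≗q zero with q x′
... | true  = cong suc (entryCount-cong p q w w′ (p≗q ∘ suc))
... | false = entryCount-cong p q w w′ (p≗q ∘ suc)

entryCount-none : (p : A → Bool) (w : Vec A n) → (∀ j → ¬ T (p (lookup w j))) → entryCount p w ≡ 0
entryCount-none p []      none = refl
entryCount-none p (x ∷ w) none with p x in px
... | true  = ⊥-elim (none zero (subst T (sym px) _))
... | false = entryCount-none p w (none ∘ suc)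

entryCount-some : (p : A → Bool) (w : Vec A n) (j : Fin n) → T (p (lookup w j)) → entryCount p w ≢ 0
entryCount-some p (x ∷ w) zero    pj with p x
... | true = λ ()
entryCount-some p (x ∷ w) (suc j) pj with p x
... | true  = λ ()
... | false = entryCount-some p w j pj

-- Linear algebra over F₂

⊕-self : (x : Vec Bool m) → x ⊕ x ≡ 𝟎
⊕-self []      = refl
⊕-self (a ∷ x) = cong₂ _∷_ (xor-same a) (⊕-self x)

⊕-isAbelianGroup : IsAbelianGroup _≡_ (_⊕_ {m}) 𝟎 id
⊕-isAbelianGroup = record
  { isGroup = record
    { isMonoid = record
      { isSemigroup = record
        { isMagma = record { isEquivalence = isEquivalence ; ∙-cong = cong₂ _⊕_ }
        ; assoc   = zipWith-assoc xor-assoc }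
      ; identity = zipWith-identityˡ xor-identityˡ , zipWith-identityʳ xor-identityʳ }
    ; inverse = ⊕-self , ⊕-self
    ; ⁻¹-cong = cong id }
  ; comm = zipWith-comm xor-comm }

⊕-abelianGroup : ℕ → AbelianGroup 0ℓ 0ℓ
⊕-abelianGroup m = record { isAbelianGroup = ⊕-isAbelianGroup {m} }

module _ {m : ℕ} where
  open AbelianGroup (⊕-abelianGroup m) public
    using () renaming (assoc to ⊕-assoc; comm to ⊕-comm; identityˡ to ⊕-identityˡ; identityʳ to ⊕-identityʳ)
  open CommutativeSemigroupProperties (AbelianGroup.commutativeSemigroup (⊕-abelianGroup m)) public
    using () renaming (interchange to ⊕-interchange; x∙yz≈y∙xz to ⊕-left-comm)
  private module G = AbelianGroupProperties (⊕-abelianGroup m)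

  ⊕≡𝟎⇒≡ : (x y : Vec Bool m) → x ⊕ y ≡ 𝟎 → x ≡ y
  ⊕≡𝟎⇒≡ = G.inverseˡ-unique

  x⊕[x⊕y]≡y : (x y : Vec Bool m) → x ⊕ (x ⊕ y) ≡ y
  x⊕[x⊕y]≡y = G.\\-leftDividesˡ

  [x⊕y]⊕y≡x : (x y : Vec Bool m) → (x ⊕ y) ⊕ y ≡ x
  [x⊕y]⊕y≡x x y = G.//-rightDividesʳ y x

  [x⊕y]⊕x≡y : (x y : Vec Bool m) → (x ⊕ y) ⊕ x ≡ y
  [x⊕y]⊕x≡y = G.xyx⁻¹≈y

if-⊕ : (a b : Bool) (v : Vec Bool m) → (if a xor b then v else 𝟎) ≡ (if a then v else 𝟎) ⊕ (if b then v else 𝟎)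
if-⊕ false b     v = sym (⊕-identityˡ _)
if-⊕ true  false v = sym (⊕-identityʳ v)
if-⊕ true  true  v = sym (⊕-self v)

lincomb-𝟎 : (b : Vec (Vec Bool m) k) → lincomb 𝟎 b ≡ 𝟎
lincomb-𝟎 []      = refl
lincomb-𝟎 (_ ∷ b) = trans (⊕-identityˡ _) (lincomb-𝟎 b)

lincomb-⊕ : (u u′ : Vec Bool k) (b : Vec (Vec Bool m) k) → lincomb (u ⊕ u′) b ≡ lincomb u b ⊕ lincomb u′ b
lincomb-⊕ []      []        []      = sym (⊕-identityˡ 𝟎)
lincomb-⊕ (x ∷ u) (x′ ∷ u′) (v ∷ b) =
  trans (cong₂ _⊕_ (if-⊕ x x′ v) (lincomb-⊕ u u′ b)) (⊕-interchange _ _ _ _)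

lincomb-lincomb : (u : Vec Bool n) (cs : Vec (Vec Bool k) n) (b : Vec (Vec Bool m) k) →
                  lincomb u (V.map (λ c → lincomb c b) cs) ≡ lincomb (lincomb u cs) b
lincomb-lincomb []      []       b = sym (lincomb-𝟎 b)
lincomb-lincomb (x ∷ u) (c ∷ cs) b = begin
  (if x then lincomb c b else 𝟎) ⊕ lincomb u (V.map (λ c → lincomb c b) cs)
    ≡⟨ cong₂ _⊕_ (if-lincomb x) (lincomb-lincomb u cs b) ⟩
  lincomb (if x then c else 𝟎) b ⊕ lincomb (lincomb u cs) b
    ≡⟨ lincomb-⊕ (if x then c else 𝟎) (lincomb u cs) b ⟨
  lincomb ((if x then c else 𝟎) ⊕ lincomb u cs) b
    ∎
  where
  open ≡-Reasoning
  if-lincomb : ∀ x → (if x then lincomb c b else 𝟎) ≡ lincomb (if x then c else 𝟎) b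
  if-lincomb true  = refl
  if-lincomb false = sym (lincomb-𝟎 b)

lincomb-unit : (vs : Vec (Vec Bool m) n) (i : Fin n) → lincomb (𝟎 V.[ i ]≔ true) vs ≡ lookup vs i
lincomb-unit (v ∷ vs) zero    = trans (cong (v ⊕_) (lincomb-𝟎 vs)) (⊕-identityʳ v)
lincomb-unit (v ∷ vs) (suc i) = trans (⊕-identityˡ _) (lincomb-unit vs i)

lincomb-translate : (c : Vec Bool n) (vs : Vec (Vec Bool m) n) (i : Fin n) (d : Vec Bool m) → lookup c i ≡ true →
                    lincomb c (vs [ i ]%= (d ⊕_)) ≡ d ⊕ lincomb c vs
lincomb-translate (true ∷ c) (v ∷ vs) zero    d refl = ⊕-assoc d v _
lincomb-translate (x ∷ c)    (v ∷ vs) (suc i) d cᵢ   =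
  trans (cong (_ ⊕_) (lincomb-translate c vs i d cᵢ)) (⊕-left-comm _ d _)

lincomb-false∷ : (w : Vec Bool n) (cs : Vec (Vec Bool k) n) → lincomb w (V.map (false ∷_) cs) ≡ false ∷ lincomb w cs
lincomb-false∷ []      []       = refl
lincomb-false∷ (x ∷ w) (c ∷ cs) rewrite lincomb-false∷ w cs with x
... | true  = refl
... | false = refl

coset : Vec (Vec Bool m) k → Vec Bool m → Subset m
coset b d v = inSpan b (v ⊕ d)

inSpan-reflects : (b : Vec (Vec Bool m) k) (v : Vec Bool m) → Reflects (∃ λ u → lincomb u b ≡ v) (inSpan b v)
inSpan-reflects b v = any-reflects ∈-allVecs _ (λ u → ==ᵛ-reflects (lincomb u b) v)

inSpan-lincomb : (b : Vec (Vec Bool m) k) (u : Vec Bool k) → T (inSpan b (lincomb u b))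
inSpan-lincomb b u = reflects-complete (inSpan-reflects b _) (u , refl)

inSpan-𝟎 : (b : Vec (Vec Bool m) k) → T (inSpan b 𝟎)
inSpan-𝟎 b = subst (T ∘ inSpan b) (lincomb-𝟎 b) (inSpan-lincomb b 𝟎)

inSpan-⊕ : (b : Vec (Vec Bool m) k) {x y : Vec Bool m} → T (inSpan b x) → T (inSpan b y) → T (inSpan b (x ⊕ y))
inSpan-⊕ b x∈ y∈ with reflects-sound (inSpan-reflects b _) x∈ | reflects-sound (inSpan-reflects b _) y∈
... | u , refl | u′ , refl = subst (T ∘ inSpan b) (lincomb-⊕ u u′ b) (inSpan-lincomb b (u ⊕ u′))

coset-difference : (b : Vec (Vec Bool m) k) (d : Vec Bool m) {x y : Vec Bool m} →
                   T (coset b d x) → T (coset b d y) → T (inSpan b (x ⊕ y))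
coset-difference b d {x} {y} x∈ y∈ = subst (T ∘ inSpan b) (begin
  (x ⊕ d) ⊕ (y ⊕ d)   ≡⟨ ⊕-interchange x d y d ⟩
  (x ⊕ y) ⊕ (d ⊕ d)   ≡⟨ cong ((x ⊕ y) ⊕_) (⊕-self d) ⟩
  (x ⊕ y) ⊕ 𝟎         ≡⟨ ⊕-identityʳ (x ⊕ y) ⟩
  x ⊕ y               ∎) (inSpan-⊕ b x∈ y∈)
  where open ≡-Reasoning

offset∈coset : (b : Vec (Vec Bool m) k) (d : Vec Bool m) → T (coset b d d)
offset∈coset b d = subst (T ∘ inSpan b) (sym (⊕-self d)) (inSpan-𝟎 b)

inSpan-translate : (b : Vec (Vec Bool m) k) {t : Vec Bool m} → T (inSpan b t) → ∀ x → inSpan b (x ⊕ t) ≡ inSpan b x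
inSpan-translate b t∈ x = T-⇔⇒≡
  (λ x⊕t∈ → subst (T ∘ inSpan b) ([x⊕y]⊕y≡x x _) (inSpan-⊕ b x⊕t∈ t∈))
  (λ x∈ → inSpan-⊕ b x∈ t∈)

inSpan-unique : (b : Vec (Vec Bool m) k) (b′ : Vec (Vec Bool m) n) (d d′ : Vec Bool m) →
                coset b d ≗ coset b′ d′ → inSpan b ≗ inSpan b′
inSpan-unique b b′ d d′ same-coset x = begin
  inSpan b x                   ≡⟨ cong (inSpan b) ([x⊕y]⊕y≡x x d) ⟨
  inSpan b ((x ⊕ d) ⊕ d)       ≡⟨ same-coset (x ⊕ d) ⟩
  inSpan b′ ((x ⊕ d) ⊕ d′)     ≡⟨ cong (inSpan b′) (⊕-assoc x d d′) ⟩
  inSpan b′ (x ⊕ (d ⊕ d′))     ≡⟨ inSpan-translate b′ d⊕d′∈ x ⟩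
  inSpan b′ x                  ∎
  where
  open ≡-Reasoning
  d⊕d′∈ : T (inSpan b′ (d ⊕ d′))
  d⊕d′∈ = subst T (same-coset d) (offset∈coset b d)

Independent : Vec (Vec Bool m) k → Set
Independent b = ∀ u → lincomb u b ≡ 𝟎 → u ≡ 𝟎

independent-reflects : (b : Vec (Vec Bool m) k) → Reflects (Independent b) (independent b)
independent-reflects b =
  all-reflects ∈-allVecs _ (λ u → ==ᵛ-reflects (lincomb u b) 𝟎 →-reflects ==ᵛ-reflects u 𝟎)

lincomb-injective : {b : Vec (Vec Bool m) k} → Independent b → ∀ {u u′} → lincomb u b ≡ lincomb u′ b → u ≡ u′
lincomb-injective {b = b} b-independent {u} {u′} eq =
  ⊕≡𝟎⇒≡ u u′ (b-independent (u ⊕ u′)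
    (trans (lincomb-⊕ u u′ b) (trans (cong (_⊕ lincomb u′ b) eq) (⊕-self _))))

isSubspaceDim-reflects : (k : ℕ) (S : Subset m) →
  Reflects (∃ λ (b : Vec (Vec Bool m) k) → Independent b × S ≗ inSpan b) (isSubspaceDim k S)
isSubspaceDim-reflects k S = any-reflects ∈-tuples _ (λ b →
  independent-reflects b ×-reflects all-reflects ∈-allVecs _ (λ v → xnor-reflects (S v) (inSpan b v)))

isCoset-reflects : (U D : Subset m) → Reflects (∃ λ d → ∀ v → D v ≡ U (v ⊕ d)) (isCoset U D)
isCoset-reflects U D =
  any-reflects ∈-allVecs _ (λ d → all-reflects ∈-allVecs _ (λ v → xnor-reflects (D v) (U (v ⊕ d))))

record SpanBasis (vs : Vec (Vec Bool m) n) (k : ℕ) : Set where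
  field
    basis             : Vec (Vec Bool m) k
    basis-independent : Independent basis
    coords            : Vec (Vec Bool k) n
    vs≡coords·basis   : vs ≡ V.map (λ c → lincomb c basis) coords
    coords-spanning   : ∀ u → ∃ λ w → lincomb w coords ≡ u

spanBasis : (vs : Vec (Vec Bool m) n) → ∃ λ k → k ≤ n × SpanBasis vs k
spanBasis [] = 0 , z≤n , record
  { basis = [] ; basis-independent = λ { [] _ → refl }
  ; coords = [] ; vs≡coords·basis = refl ; coords-spanning = λ { [] → [] , refl } }
spanBasis (v ∷ vs) with spanBasis vs
... | k , k≤n , B with inSpan (SpanBasis.basis B) v in v∈?
...   | true  = k , m≤n⇒m≤1+n k≤n , record
  { basis = basis ; basis-independent = basis-independent
  ; coords = proj₁ v-coords ∷ coords
  ; vs≡coords·basis = cong₂ _∷_ (sym (proj₂ v-coords)) vs≡coords·basis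
  ; coords-spanning = λ u → let w , w·c≡u = coords-spanning u in false ∷ w , trans (⊕-identityˡ _) w·c≡u }
  where
  open SpanBasis B
  v-coords : ∃ λ u → lincomb u basis ≡ v
  v-coords = reflects-sound (inSpan-reflects basis v) (subst T (sym v∈?) _)
...   | false = suc k , s≤s k≤n , record
  { basis = v ∷ basis ; basis-independent = v∷basis-independent
  ; coords = (true ∷ 𝟎) ∷ V.map (false ∷_) coords
  ; vs≡coords·basis = cong₂ _∷_ (sym (lincomb-unit (v ∷ basis) zero))
      (trans vs≡coords·basis (trans (map-cong (λ c → sym (⊕-identityˡ _)) coords) (map-∘ _ (false ∷_) coords)))
  ; coords-spanning = spanning }
  where
  open SpanBasis B
  v∷basis-independent : Independent (v ∷ basis)
  v∷basis-independent (true ∷ u) v⊕u·b≡𝟎 =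
    ⊥-elim (subst T v∈? (reflects-complete (inSpan-reflects basis v) (u , sym (⊕≡𝟎⇒≡ v _ v⊕u·b≡𝟎))))
  v∷basis-independent (false ∷ u) 𝟎⊕u·b≡𝟎 =
    cong (false ∷_) (basis-independent u (trans (sym (⊕-identityˡ _)) 𝟎⊕u·b≡𝟎))
  spanning : ∀ u → ∃ λ w → lincomb w ((true ∷ 𝟎) ∷ V.map (false ∷_) coords) ≡ u
  spanning (x ∷ u) with coords-spanning u
  ... | w , refl = x ∷ w , trans (cong (_ ⊕_) (lincomb-false∷ w coords)) (head-tail x)
    where
    head-tail : ∀ x → (if x then true ∷ 𝟎 else 𝟎) ⊕ (false ∷ lincomb w coords) ≡ x ∷ lincomb w coords
    head-tail true  = cong (true ∷_) (⊕-identityˡ _)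
    head-tail false = cong (false ∷_) (⊕-identityˡ _)

cosetMonomial-on : (r : ℕ) (D : Subset m) {v : Vec Bool m} → T (D v) → cosetMonomial r D v ≡ r
cosetMonomial-on r D {v} v∈D with D v
... | true = refl

cosetMonomial-support : (r : ℕ) (D : Subset m) (v : Vec Bool m) → cosetMonomial r D v ≢ 0 → T (D v)
cosetMonomial-support r D v c≢0 with D v
... | true  = _
... | false = c≢0 refl

cosetMonomial-injective : {D D′ : Subset m} → r ≢ 0 → cosetMonomial r D ≗ cosetMonomial r D′ → D ≗ D′
cosetMonomial-injective {D = D} {D′} r≢0 eq v with D v | D′ v | eq v
... | true  | true  | _  = refl
... | false | false | _  = refl
... | true  | false | eq = ⊥-elim (r≢0 eq)
... | false | true  | eq = ⊥-elim (r≢0 (sym eq))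

record IsCosetMonomial (k r : ℕ) (e : Monomial m) : Set where
  field
    offset            : Vec Bool m
    basis             : Vec (Vec Bool m) k
    basis-independent : Independent basis
    exponents         : e ≗ cosetMonomial r (coset basis offset)

IsCosetMonomial-resp : {μ ν : Monomial m} → μ ≗ ν → IsCosetMonomial k r μ → IsCosetMonomial k r ν
IsCosetMonomial-resp μ≗ν E = record
  { offset = offset ; basis = basis ; basis-independent = basis-independent
  ; exponents = λ v → trans (sym (μ≗ν v)) (exponents v) }
  where open IsCosetMonomial E

isCosetMonomial-multiplicity : {e : Monomial m} {r′ : ℕ} →
                               IsCosetMonomial k r e → IsCosetMonomial n r′ e → r ≢ 0 → r ≡ r′
isCosetMonomial-multiplicity {r = r} {e = e} {r′} E E′ r≢0 = begin
  r                                  ≡⟨ e[d]≡r ⟨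
  e d                                ≡⟨ IsCosetMonomial.exponents E′ d ⟩
  cosetMonomial r′ coset′ d          ≡⟨ cosetMonomial-on r′ coset′ d∈coset′ ⟩
  r′                                 ∎
  where
  open ≡-Reasoning
  open IsCosetMonomial E using (basis; exponents) renaming (offset to d)
  coset′ : Subset _
  coset′ = coset (IsCosetMonomial.basis E′) (IsCosetMonomial.offset E′)
  e[d]≡r : e d ≡ r
  e[d]≡r = trans (exponents d) (cosetMonomial-on r (coset basis d) (offset∈coset basis d))
  d∈coset′ : T (coset′ d)
  d∈coset′ = cosetMonomial-support r′ coset′ d λ c≡0 →
    r≢0 (trans (sym e[d]≡r) (trans (IsCosetMonomial.exponents E′ d) c≡0))

-- The code H₈ ⊗ F_{2^m}

column : Fin 8 → Vec Bool 4
column j = V.map (λ g → lookup g j) gen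

combo-lookup : (ls : Vec (Vec Bool m) 4) (j : Fin 8) → lookup (combo ls) j ≡ lincomb (column j) ls
combo-lookup ls@(_ ∷ _ ∷ _ ∷ _ ∷ []) j = lookup∘tabulate (λ j → lincomb (column j) ls) j

column-last : (j : Fin 8) → lookup (column j) (# 3) ≡ true
column-last zero = refl
column-last (suc zero) = refl
column-last (suc (suc zero)) = refl
column-last (suc (suc (suc zero))) = refl
column-last (suc (suc (suc (suc zero)))) = refl
column-last (suc (suc (suc (suc (suc zero))))) = refl
column-last (suc (suc (suc (suc (suc (suc zero)))))) = refl
column-last (suc (suc (suc (suc (suc (suc (suc zero))))))) = refl

-- Positions 0, 4, 2, 1 form an information set: there the codeword reads x₄, x₁ ⊕ x₄, x₂ ⊕ x₄, x₃ ⊕ x₄.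
decode : Word m → Vec (Vec Bool m) 4
decode w = (lookup w (# 4) ⊕ lookup w (# 0)) ∷ (lookup w (# 2) ⊕ lookup w (# 0))
         ∷ (lookup w (# 1) ⊕ lookup w (# 0)) ∷ lookup w (# 0) ∷ []

decode-combo : (ls : Vec (Vec Bool m) 4) → decode (combo ls) ≡ ls
decode-combo ls@(_ ∷ _ ∷ _ ∷ _ ∷ []) =
  cong₂ _∷_ (difference (# 4) (# 0) refl)
    (cong₂ _∷_ (difference (# 2) (# 1) refl)
      (cong₂ _∷_ (difference (# 1) (# 2) refl)
        (cong (_∷ []) (trans (combo-lookup ls (# 0)) (lincomb-unit ls (# 3))))))
  where
  difference : ∀ j i → column j ⊕ column (# 0) ≡ 𝟎 V.[ i ]≔ true →
               lookup (combo ls) j ⊕ lookup (combo ls) (# 0) ≡ lookup ls i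
  difference j i unit = begin
    lookup (combo ls) j ⊕ lookup (combo ls) (# 0)      ≡⟨ cong₂ _⊕_ (combo-lookup ls j) (combo-lookup ls (# 0)) ⟩
    lincomb (column j) ls ⊕ lincomb (column (# 0)) ls  ≡⟨ lincomb-⊕ (column j) (column (# 0)) ls ⟨
    lincomb (column j ⊕ column (# 0)) ls               ≡⟨ cong (λ c → lincomb c ls) unit ⟩
    lincomb (𝟎 V.[ i ]≔ true) ls                       ≡⟨ lincomb-unit ls i ⟩
    lookup ls i                                        ∎
    where open ≡-Reasoning

combo-injective : {ls ls′ : Vec (Vec Bool m) 4} → combo ls ≡ combo ls′ → ls ≡ ls′
combo-injective {ls = ls} {ls′} eq = trans (sym (decode-combo ls)) (trans (cong decode eq) (decode-combo ls′))

zipWith-==ᵛ-does : (u w : Vec (Vec Bool m) n) →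
                   V.foldr _ (λ b acc → b ∧ acc) true (V.zipWith _==ᵛ_ u w) ≡ does (≡-dec _≟ᵛ_ u w)
zipWith-==ᵛ-does []      []      = refl
zipWith-==ᵛ-does (x ∷ u) (y ∷ w) = cong ((x ==ᵛ y) ∧_) (zipWith-==ᵛ-does u w)

inCode-reflects : (w : Word m) → Reflects (∃ λ ls → combo ls ≡ w) (inCode w)
inCode-reflects w = any-reflects ∈-tuples _ (λ ls →
  subst (Reflects (combo ls ≡ w)) (sym (zipWith-==ᵛ-does (combo ls) w)) (proof (≡-dec _≟ᵛ_ (combo ls) w)))

codewordCount : Monomial m → ℕ
codewordCount {m} e = count (λ ls → composition (combo ls) ==ᵐ e) (allVecsOf (allVecs m) 4)

coeff-cwe : (e : Monomial m) → coeff e (cwe-H8 m) ≡ codewordCount e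
coeff-cwe {m} e = begin
  count (_==ᵐ e) (map composition (filterᵇ inCode words))
    ≡⟨ count-map (_==ᵐ e) composition (filterᵇ inCode words) ⟩
  count (λ w → composition w ==ᵐ e) (filterᵇ inCode words)
    ≡⟨ count-filterᵇ _ inCode words ⟩
  count (λ w → inCode w ∧ (composition w ==ᵐ e)) words
    ≡⟨ reindex ⟩
  count (λ ls → inCode (combo ls) ∧ (composition (combo ls) ==ᵐ e)) tuples
    ≡⟨ count-cong tuples (λ ls → cong (_∧ (composition (combo ls) ==ᵐ e)) (inCode-combo ls)) ⟩
  codewordCount e
    ∎
  where
  open ≡-Reasoning
  words : List (Word m)
  words = allVecsOf (allVecs m) 8
  tuples : List (Vec (Vec Bool m) 4)
  tuples = allVecsOf (allVecs m) 4
  inCode-combo : ∀ ls → inCode (combo ls) ≡ true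
  inCode-combo ls = Equivalence.to T-≡ (reflects-complete (inCode-reflects (combo ls)) (ls , refl))
  reindex : count (λ w → inCode w ∧ (composition w ==ᵐ e)) words
          ≡ count (λ ls → inCode (combo ls) ∧ (composition (combo ls) ==ᵐ e)) tuples
  reindex = count-reindex (≡-dec _≟ᵛ_) (≡-dec _≟ᵛ_) words tuples (tuples-enumeratesOnce m 8) (tuples-enumeratesOnce m 4)
    combo combo-injective (λ w → inCode w ∧ (composition w ==ᵐ e))
    (λ w q → reflects-sound (inCode-reflects w) (proj₁ (Equivalence.to T-∧ q)))

uniformCount : (k r : ℕ) → ℕ
uniformCount k r = count (λ ls → composition (combo ls) ==ᵐ (λ _ → r)) (allVecsOf (allVecs k) 4)

-- Codewords transported along an affine embedding F₂^k → F₂^m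

module AffineImage (b : Vec (Vec Bool m) k) (d : Vec Bool m) where

  φ : Vec Bool k → Vec Bool m
  φ u = d ⊕ lincomb u b

  -- Translating the coefficient of the all-ones row by d translates every entry by d.
  lift : Vec (Vec Bool k) 4 → Vec (Vec Bool m) 4
  lift ls = V.map (λ u → lincomb u b) ls [ # 3 ]%= (d ⊕_)

  combo-lift : (ls : Vec (Vec Bool k) 4) (j : Fin 8) → lookup (combo (lift ls)) j ≡ φ (lookup (combo ls) j)
  combo-lift ls j = begin
    lookup (combo (lift ls)) j
      ≡⟨ combo-lookup (lift ls) j ⟩
    lincomb (column j) (lift ls)
      ≡⟨ lincomb-translate (column j) (V.map (λ u → lincomb u b) ls) (# 3) d (column-last j) ⟩
    d ⊕ lincomb (column j) (V.map (λ u → lincomb u b) ls)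
      ≡⟨ cong (d ⊕_) (lincomb-lincomb (column j) ls b) ⟩
    d ⊕ lincomb (lincomb (column j) ls) b
      ≡⟨ cong φ (combo-lookup ls j) ⟨
    φ (lookup (combo ls) j)
      ∎
    where open ≡-Reasoning

  φ∈coset : (u : Vec Bool k) → T (coset b d (φ u))
  φ∈coset u = subst (T ∘ inSpan b) (sym ([x⊕y]⊕x≡y d (lincomb u b))) (inSpan-lincomb b u)

  ∈coset⇒φ : {v : Vec Bool m} → T (coset b d v) → ∃ λ u → φ u ≡ v
  ∈coset⇒φ {v} v∈ with reflects-sound (inSpan-reflects b (v ⊕ d)) v∈
  ... | u , u·b≡v⊕d = u , trans (cong (d ⊕_) u·b≡v⊕d) (trans (cong (d ⊕_) (⊕-comm v d)) (x⊕[x⊕y]≡y d v))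

  entries-in-coset⇒lifted : (w : Vec (Vec Bool m) 4) → (∀ j → T (coset b d (lookup (combo w) j))) →
                            ∃ λ ls → lift ls ≡ w
  entries-in-coset⇒lifted w in-coset
    with ∈coset⇒φ (in-coset (# 0))
       | reflects-sound (inSpan-reflects b _) (coset-difference b d (in-coset (# 4)) (in-coset (# 0)))
       | reflects-sound (inSpan-reflects b _) (coset-difference b d (in-coset (# 2)) (in-coset (# 0)))
       | reflects-sound (inSpan-reflects b _) (coset-difference b d (in-coset (# 1)) (in-coset (# 0)))
  ... | u₄ , e₄ | u₁ , e₁ | u₂ , e₂ | u₃ , e₃ =
    u₁ ∷ u₂ ∷ u₃ ∷ u₄ ∷ [] ,
    trans (cong₂ _∷_ e₁ (cong₂ _∷_ e₂ (cong₂ _∷_ e₃ (cong (_∷ []) e₄)))) (decode-combo w)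

  module _ (b-independent : Independent b) where

    φ-injective : {u u′ : Vec Bool k} → φ u ≡ φ u′ → u ≡ u′
    φ-injective {u} {u′} eq = lincomb-injective b-independent (begin
      lincomb u b              ≡⟨ x⊕[x⊕y]≡y d (lincomb u b) ⟨
      d ⊕ (d ⊕ lincomb u b)    ≡⟨ cong (d ⊕_) eq ⟩
      d ⊕ (d ⊕ lincomb u′ b)   ≡⟨ x⊕[x⊕y]≡y d (lincomb u′ b) ⟩
      lincomb u′ b             ∎)
      where open ≡-Reasoning

    lift-injective : {ls ls′ : Vec (Vec Bool k) 4} → lift ls ≡ lift ls′ → ls ≡ ls′
    lift-injective {ls@(_ ∷ _ ∷ _ ∷ _ ∷ [])} {ls′@(_ ∷ _ ∷ _ ∷ _ ∷ [])} eq =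
      cong₂ _∷_ (lincomb-injective b-independent (at (# 0)))
        (cong₂ _∷_ (lincomb-injective b-independent (at (# 1)))
          (cong₂ _∷_ (lincomb-injective b-independent (at (# 2)))
            (cong (_∷ []) (φ-injective (at (# 3))))))
      where
      at : ∀ i → lookup (lift ls) i ≡ lookup (lift ls′) i
      at i = cong (λ w → lookup w i) eq

    composition-lift-φ : (ls : Vec (Vec Bool k) 4) (u : Vec Bool k) →
                         composition (combo (lift ls)) (φ u) ≡ composition (combo ls) u
    composition-lift-φ ls u = entryCount-cong (_==ᵛ φ u) (_==ᵛ u) (combo (lift ls)) (combo ls) λ j →
      trans (cong (_==ᵛ φ u) (combo-lift ls j))
            (reflects-⇔ (==ᵛ-reflects (φ (lookup (combo ls) j)) (φ u)) (==ᵛ-reflects (lookup (combo ls) j) u)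
                         φ-injective (cong φ))

    composition-lift-outside : (ls : Vec (Vec Bool k) 4) {v : Vec Bool m} → ¬ T (coset b d v) →
                               composition (combo (lift ls)) v ≡ 0
    composition-lift-outside ls {v} v∉ = entryCount-none (_==ᵛ v) (combo (lift ls)) λ j eq →
      v∉ (subst (T ∘ coset b d) (trans (sym (combo-lift ls j)) (==ᵛ-sound _ v eq)) (φ∈coset (lookup (combo ls) j)))

    uniform⇒coset : (r : ℕ) (ls : Vec (Vec Bool k) 4) → composition (combo ls) ≗ (λ _ → r) →
                    composition (combo (lift ls)) ≗ cosetMonomial r (coset b d)
    uniform⇒coset r ls uniform v with coset b d v in v∈?
    ... | true  = let u , φu≡v = ∈coset⇒φ (subst T (sym v∈?) _) in
      trans (cong (composition (combo (lift ls))) (sym φu≡v)) (trans (composition-lift-φ ls u) (uniform u))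
    ... | false = composition-lift-outside ls (subst T v∈?)

    coset⇒uniform : (r : ℕ) (ls : Vec (Vec Bool k) 4) → composition (combo (lift ls)) ≗ cosetMonomial r (coset b d) →
                    composition (combo ls) ≗ (λ _ → r)
    coset⇒uniform r ls on-coset u =
      trans (sym (composition-lift-φ ls u)) (trans (on-coset (φ u)) (cosetMonomial-on r (coset b d) (φ∈coset u)))

    count-lift : (r : ℕ) (e : Monomial m) → e ≗ cosetMonomial r (coset b d) →
                 codewordCount e ≡ uniformCount k r
    count-lift r e e-coset = trans reindex (count-cong (allVecsOf (allVecs k) 4) same-condition)
      where
      onto : ∀ w → T (composition (combo w) ==ᵐ e) → ∃ λ ls → lift ls ≡ w
      onto w comp≗e = entries-in-coset⇒lifted w λ j →
        let v = lookup (combo w) j in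
        cosetMonomial-support r (coset b d) v λ c≡0 →
          entryCount-some (_==ᵛ v) (combo w) j (==ᵛ-refl v)
            (trans (reflects-sound (==ᵐ-reflects (composition (combo w)) e) comp≗e v) (trans (e-coset v) c≡0))
      reindex : codewordCount e ≡ count (λ ls → composition (combo (lift ls)) ==ᵐ e) (allVecsOf (allVecs k) 4)
      reindex = count-reindex (≡-dec _≟ᵛ_) (≡-dec _≟ᵛ_) (allVecsOf (allVecs m) 4) (allVecsOf (allVecs k) 4)
                  (tuples-enumeratesOnce m 4) (tuples-enumeratesOnce k 4)
                  lift lift-injective (λ w → composition (combo w) ==ᵐ e) onto
      same-condition : ∀ ls → (composition (combo (lift ls)) ==ᵐ e) ≡ (composition (combo ls) ==ᵐ (λ _ → r))
      same-condition ls = reflects-⇔ (==ᵐ-reflects _ e) (==ᵐ-reflects _ (λ _ → r))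
        (λ c≗e → coset⇒uniform r ls (λ v → trans (c≗e v) (e-coset v)))
        (λ uniform v → trans (uniform⇒coset r ls uniform v) (sym (e-coset v)))

codewordCount-isCosetMonomial : {e : Monomial m} → IsCosetMonomial k r e → codewordCount e ≡ uniformCount k r
codewordCount-isCosetMonomial {r = r} {e = e} E = AffineImage.count-lift basis offset basis-independent r e exponents
  where open IsCosetMonomial E

SpanningIsUniform : (k r : ℕ) → Set
SpanningIsUniform k r =
  (cs : Vec (Vec Bool k) 3) → (∀ u → T (inSpan cs u)) → composition (combo (cs V.∷ʳ 𝟎)) ≗ (λ _ → r)

spanningIsUniform-reflects : (k r : ℕ) → Reflects (SpanningIsUniform k r)
  (all (λ cs → not (all (inSpan cs) (allVecs k)) ∨ (composition (combo (cs V.∷ʳ 𝟎)) ==ᵐ (λ _ → r)))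
       (allVecsOf (allVecs k) 3))
spanningIsUniform-reflects k r = all-reflects ∈-tuples _ (λ cs →
  all-reflects ∈-allVecs _ (λ u → T-reflects (inSpan cs u)) →-reflects ==ᵐ-reflects _ _)

codeword-isCosetMonomial : {x₁ x₂ x₃ : Vec Bool m} (x₄ : Vec Bool m) →
                           SpanBasis (x₁ ∷ x₂ ∷ x₃ ∷ []) k → SpanningIsUniform k r →
                           IsCosetMonomial k r (composition (combo (x₁ ∷ x₂ ∷ x₃ ∷ x₄ ∷ [])))
codeword-isCosetMonomial {r = r} {x₁} {x₂} {x₃} x₄ B uniform = record
  { offset = x₄ ; basis = basis ; basis-independent = basis-independent ; exponents = exponents }
  where
  open SpanBasis B
  open AffineImage basis x₄
  coords-span : ∀ u → T (inSpan coords u)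
  coords-span u = reflects-complete (inSpan-reflects coords u) (coords-spanning u)
  lift-coords : lift (coords V.∷ʳ 𝟎) ≡ x₁ ∷ x₂ ∷ x₃ ∷ x₄ ∷ []
  lift-coords with coords | vs≡coords·basis
  ... | c₁ ∷ c₂ ∷ c₃ ∷ [] | x≡c·b =
    cong₂ V._++_ (sym x≡c·b) (cong (_∷ []) (trans (cong (x₄ ⊕_) (lincomb-𝟎 basis)) (⊕-identityʳ x₄)))
  exponents : composition (combo (x₁ ∷ x₂ ∷ x₃ ∷ x₄ ∷ [])) ≗ cosetMonomial r (coset basis x₄)
  exponents = subst (λ w → composition (combo w) ≗ cosetMonomial r (coset basis x₄)) lift-coords
    (uniform⇒coset basis-independent r (coords V.∷ʳ 𝟎) (uniform coords coords-span))

-- Coefficients of the right-hand side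

cosetCount : (k r : ℕ) → Monomial m → ℕ
cosetCount {m} k r e = coeff e (cosetSum m k r)

cosetCount≢0 : (e : Monomial m) → cosetCount k r e ≢ 0 → IsCosetMonomial k r e
cosetCount≢0 {m} {k} {r} e c≢0
  with Any.satisfied (Any-filterᵇ⁻ _ (allSets m)
         (concatMap⁻ (λ U → map (cosetMonomial r) (cosets U)) (count≢0⇒Any (_==ᵐ e) (cosetSum m k r) c≢0)))
... | U , U-subspace , D-coset
  with Any.satisfied (Any-filterᵇ⁻ _ (allSets m) (map⁻ D-coset))
... | D , D∈U , D≗e
  with reflects-sound (isSubspaceDim-reflects k U) U-subspace | reflects-sound (isCoset-reflects U D) D∈U
... | b , b-independent , U≗span | d , D≡U = record
  { offset = d ; basis = b ; basis-independent = b-independent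
  ; exponents = λ v → trans (sym (reflects-sound (==ᵐ-reflects (cosetMonomial r D) e) D≗e v))
                            (cong (λ x → if x then r else 0) (trans (D≡U v) (U≗span (v ⊕ d)))) }

count-cosets-with-monomial : (U S : Subset m) {e : Monomial m} → r ≢ 0 → e ≗ cosetMonomial r S →
  count (λ D → isCoset U D ∧ (cosetMonomial r D ==ᵐ e)) (allSets m) ≡ (if isCoset U S then 1 else 0)
count-cosets-with-monomial {m} {r} U S {e} r≢0 e≗S = begin
  count (λ D → isCoset U D ∧ (cosetMonomial r D ==ᵐ e)) (allSets m)
    ≡⟨ count-cong (allSets m) (λ D → reflects-⇔
         (isCoset-reflects U D ×-reflects ==ᵐ-reflects (cosetMonomial r D) e)
         (isCoset-reflects U S ×-reflects ==ˢ-reflects S D)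
         (λ { ((d , D≡) , D≗e) → let S≗D = monomial⇒coset D D≗e in (d , λ v → trans (S≗D v) (D≡ v)) , S≗D })
         (λ { ((d , S≡) , S≗D) → (d , λ v → trans (sym (S≗D v)) (S≡ v)) , coset⇒monomial D S≗D })) ⟩
  count (λ D → isCoset U S ∧ (S ==ˢ D)) (allSets m)
    ≡⟨ count-∧ˡ (isCoset U S) (S ==ˢ_) (allSets m) ⟩
  (if isCoset U S then count (S ==ˢ_) (allSets m) else 0)
    ≡⟨ cong (λ c → if isCoset U S then c else 0) (allSets-unique m S) ⟩
  (if isCoset U S then 1 else 0)
    ∎
  where
  open ≡-Reasoning
  monomial⇒coset : ∀ D → cosetMonomial r D ≗ e → S ≗ D
  monomial⇒coset D D≗e = cosetMonomial-injective r≢0 (λ v → sym (trans (D≗e v) (e≗S v)))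
  coset⇒monomial : ∀ D → S ≗ D → cosetMonomial r D ≗ e
  coset⇒monomial D S≗D v = trans (cong (λ x → if x then r else 0) (sym (S≗D v))) (sym (e≗S v))

direction-of-coset : (b : Vec (Vec Bool m) k) → Independent b → (d : Vec Bool m) (U : Subset m) →
                     isSubspaceDim k U ∧ isCoset U (coset b d) ≡ (inSpan b ==ˢ U)
direction-of-coset {k = k} b b-independent d U = reflects-⇔
  (isSubspaceDim-reflects k U ×-reflects isCoset-reflects U (coset b d)) (==ˢ-reflects (inSpan b) U)
  (λ { ((b′ , _ , U≗span) , (d′ , S≡)) v →
       trans (inSpan-unique b b′ d d′ (λ v → trans (S≡ v) (U≗span (v ⊕ d′))) v) (sym (U≗span v)) })
  (λ span≗U → (b , b-independent , λ v → sym (span≗U v)) , (d , λ v → span≗U (v ⊕ d)))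

cosetCount-isCosetMonomial : (e : Monomial m) → r ≢ 0 → IsCosetMonomial k r e → cosetCount k r e ≡ 1
cosetCount-isCosetMonomial {m} {r} {k} e r≢0 E = begin
  cosetCount k r e
    ≡⟨ count-concatMap (_==ᵐ e) (λ U → map (cosetMonomial r) (cosets U)) (G m k) ⟩
  ∑ (λ U → count (_==ᵐ e) (map (cosetMonomial r) (cosets U))) (G m k)
    ≡⟨ ∑-cong (G m k) (λ U → trans (count-map (_==ᵐ e) (cosetMonomial r) (cosets U))
                                   (count-filterᵇ _ (isCoset U) (allSets m))) ⟩
  ∑ (λ U → count (λ D → isCoset U D ∧ (cosetMonomial r D ==ᵐ e)) (allSets m)) (G m k)
    ≡⟨ ∑-cong (G m k) (λ U → count-cosets-with-monomial U S r≢0 exponents) ⟩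
  ∑ (λ U → if isCoset U S then 1 else 0) (G m k)
    ≡⟨ count≡∑ (λ U → isCoset U S) (G m k) ⟨
  count (λ U → isCoset U S) (G m k)
    ≡⟨ count-filterᵇ _ (isSubspaceDim k) (allSets m) ⟩
  count (λ U → isSubspaceDim k U ∧ isCoset U S) (allSets m)
    ≡⟨ count-cong (allSets m) (direction-of-coset basis basis-independent offset) ⟩
  count (inSpan basis ==ˢ_) (allSets m)
    ≡⟨ allSets-unique m (inSpan basis) ⟩
  1 ∎
  where
  open ≡-Reasoning
  open IsCosetMonomial E
  S : Subset m
  S = coset basis offset

pointCount : Monomial m → ℕ
pointCount {m} e = count (λ v → xpow v 8 ==ᵐ e) (allVecs m)

xpow-coset : (v : Vec Bool m) (r : ℕ) → xpow v r ≗ cosetMonomial r (coset [] v)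
xpow-coset v r w = cong (λ x → if x then r else 0) (reflects-⇔ (==ᵛ-reflects w v) (inSpan-reflects [] (w ⊕ v))
  (λ { refl → [] , sym (⊕-self w) })
  (λ { ([] , 𝟎≡w⊕v) → ⊕≡𝟎⇒≡ w v (sym 𝟎≡w⊕v) }))

pointCount≢0 : (e : Monomial m) → pointCount e ≢ 0 → IsCosetMonomial 0 8 e
pointCount≢0 {m} e c≢0 with Any.satisfied (count≢0⇒Any _ (allVecs m) c≢0)
... | v , xpow≗e = record
  { offset = v ; basis = [] ; basis-independent = λ { [] _ → refl }
  ; exponents = λ w → trans (sym (reflects-sound (==ᵐ-reflects (xpow v 8) e) xpow≗e w)) (xpow-coset v 8 w) }

pointCount-isCosetMonomial : (e : Monomial m) → IsCosetMonomial 0 8 e → pointCount e ≡ 1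
pointCount-isCosetMonomial {m} e record { offset = d ; basis = [] ; exponents = exponents } =
  trans (count-cong (allVecs m) only-d) (allVecs-enumeratesOnce m d)
  where
  only-d : ∀ v → (xpow v 8 ==ᵐ e) ≡ (d ==ᵛ v)
  only-d v = reflects-⇔ (==ᵐ-reflects (xpow v 8) e) (==ᵛ-reflects d v)
    v-is-d (λ { refl w → trans (xpow-coset d 8 w) (sym (exponents w)) })
    where
    v-is-d : xpow v 8 ≗ e → d ≡ v
    v-is-d xpow≗e with reflects-sound (inSpan-reflects [] (v ⊕ d)) (cosetMonomial-support 8 (coset [] d) v λ e[v]≡0 →
                         8≢0 (trans (sym (trans (xpow-coset v 8 v) (cosetMonomial-on 8 (coset [] v) (offset∈coset [] v))))
                                    (trans (xpow≗e v) (trans (exponents v) e[v]≡0))))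
      where
      8≢0 : 8 ≢ 0
      8≢0 ()
    ... | [] , 𝟎≡v⊕d = sym (⊕≡𝟎⇒≡ v d (sym 𝟎≡v⊕d))

data Rank : Set where
  rank0 rank1 rank2 rank3 : Rank

dim multiplicity weight : Rank → ℕ
dim rank0 = 0
dim rank1 = 1
dim rank2 = 2
dim rank3 = 3
multiplicity rank0 = 8
multiplicity rank1 = 4
multiplicity rank2 = 2
multiplicity rank3 = 1
weight rank0 = 1
weight rank1 = 14
weight rank2 = 168
weight rank3 = 1344

rankOf : ℕ → Rank
rankOf 8 = rank0
rankOf 4 = rank1
rankOf 2 = rank2
rankOf _ = rank3

rankOf-multiplicity : (κ : Rank) → rankOf (multiplicity κ) ≡ κ
rankOf-multiplicity rank0 = refl
rankOf-multiplicity rank1 = refl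
rankOf-multiplicity rank2 = refl
rankOf-multiplicity rank3 = refl

multiplicity-injective : {κ κ′ : Rank} → multiplicity κ ≡ multiplicity κ′ → κ ≡ κ′
multiplicity-injective {κ} {κ′} eq =
  trans (sym (rankOf-multiplicity κ)) (trans (cong rankOf eq) (rankOf-multiplicity κ′))

multiplicity≢0 : (κ : Rank) → multiplicity κ ≢ 0
multiplicity≢0 rank0 ()
multiplicity≢0 rank1 ()
multiplicity≢0 rank2 ()
multiplicity≢0 rank3 ()

weight≢0 : (κ : Rank) → weight κ ≢ 0
weight≢0 rank0 ()
weight≢0 rank1 ()
weight≢0 rank2 ()
weight≢0 rank3 ()

-- Finite facts about H₈ ⊗ F₂^k for k ≤ 3, decided by evaluation.
uniformCount-rank : (κ : Rank) → uniformCount (dim κ) (multiplicity κ) ≡ weight κ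
uniformCount-rank rank0 = refl
uniformCount-rank rank1 = refl
uniformCount-rank rank2 = refl
uniformCount-rank rank3 = refl

spanningIsUniform : (κ : Rank) → SpanningIsUniform (dim κ) (multiplicity κ)
spanningIsUniform κ = reflects-sound (spanningIsUniform-reflects (dim κ) (multiplicity κ)) (check κ)
  where
  check : (κ : Rank) → T (all (λ cs → not (all (inSpan cs) (allVecs (dim κ)))
                                      ∨ (composition (combo (cs V.∷ʳ 𝟎)) ==ᵐ (λ _ → multiplicity κ)))
                               (allVecsOf (allVecs (dim κ)) 3))
  check rank0 = _
  check rank1 = _
  check rank2 = _
  check rank3 = _

codeword-shape : (ls : Vec (Vec Bool m) 4) →
                 Σ Rank λ κ → IsCosetMonomial (dim κ) (multiplicity κ) (composition (combo ls))
codeword-shape (x₁ ∷ x₂ ∷ x₃ ∷ x₄ ∷ []) with spanBasis (x₁ ∷ x₂ ∷ x₃ ∷ [])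
... | 0 , _ , B = rank0 , codeword-isCosetMonomial x₄ B (spanningIsUniform rank0)
... | 1 , _ , B = rank1 , codeword-isCosetMonomial x₄ B (spanningIsUniform rank1)
... | 2 , _ , B = rank2 , codeword-isCosetMonomial x₄ B (spanningIsUniform rank2)
... | 3 , _ , B = rank3 , codeword-isCosetMonomial x₄ B (spanningIsUniform rank3)
... | suc (suc (suc (suc _))) , s≤s (s≤s (s≤s ())) , _

codewordCount≢0 : (e : Monomial m) → codewordCount e ≢ 0 → Σ Rank λ κ → IsCosetMonomial (dim κ) (multiplicity κ) e
codewordCount≢0 {m} e c≢0 with Any.satisfied (count≢0⇒Any _ (allVecsOf (allVecs m) 4) c≢0)
... | ls , composition≗e with codeword-shape ls
...   | κ , E = κ , IsCosetMonomial-resp (reflects-sound (==ᵐ-reflects (composition (combo ls)) e) composition≗e) E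

codewordCount-rank : {e : Monomial m} (κ : Rank) →
                     IsCosetMonomial (dim κ) (multiplicity κ) e → codewordCount e ≡ weight κ
codewordCount-rank κ E = trans (codewordCount-isCosetMonomial E) (uniformCount-rank κ)

rhsCount : Rank → Monomial m → ℕ
rhsCount rank0 = pointCount
rhsCount rank1 = cosetCount 1 4
rhsCount rank2 = cosetCount 2 2
rhsCount rank3 = cosetCount 3 1

rhsCount≢0 : (κ : Rank) (e : Monomial m) → rhsCount κ e ≢ 0 → IsCosetMonomial (dim κ) (multiplicity κ) e
rhsCount≢0 rank0 = pointCount≢0
rhsCount≢0 rank1 = cosetCount≢0
rhsCount≢0 rank2 = cosetCount≢0
rhsCount≢0 rank3 = cosetCount≢0

rhsCount-isCosetMonomial : (κ : Rank) (e : Monomial m) → IsCosetMonomial (dim κ) (multiplicity κ) e → rhsCount κ e ≡ 1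
rhsCount-isCosetMonomial rank0 e = pointCount-isCosetMonomial e
rhsCount-isCosetMonomial rank1 e = cosetCount-isCosetMonomial e (multiplicity≢0 rank1)
rhsCount-isCosetMonomial rank2 e = cosetCount-isCosetMonomial e (multiplicity≢0 rank2)
rhsCount-isCosetMonomial rank3 e = cosetCount-isCosetMonomial e (multiplicity≢0 rank3)

weightedSum : (Rank → ℕ) → ℕ
weightedSum f = f rank0 + (weight rank1 * f rank1 + (weight rank2 * f rank2 + weight rank3 * f rank3))

weightedSum-single : (f : Rank → ℕ) (κ : Rank) → f κ ≡ 1 → (∀ κ′ → κ′ ≢ κ → f κ′ ≡ 0) →
                     weightedSum f ≡ weight κ
weightedSum-single f rank0 one others
  rewrite one | others rank1 (λ ()) | others rank2 (λ ()) | others rank3 (λ ()) = refl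
weightedSum-single f rank1 one others
  rewrite one | others rank0 (λ ()) | others rank2 (λ ()) | others rank3 (λ ()) = refl
weightedSum-single f rank2 one others
  rewrite one | others rank0 (λ ()) | others rank1 (λ ()) | others rank3 (λ ()) = refl
weightedSum-single f rank3 one others
  rewrite one | others rank0 (λ ()) | others rank1 (λ ()) | others rank2 (λ ()) = refl

weightedSum-zero : (f : Rank → ℕ) → (∀ κ → f κ ≡ 0) → weightedSum f ≡ 0
weightedSum-zero f vanish rewrite vanish rank0 | vanish rank1 | vanish rank2 | vanish rank3 = refl

coeff-rhs : (e : Monomial m) → coeff e (rhs m) ≡ weightedSum (λ κ → rhsCount κ e)
coeff-rhs {m} e =
  trans (count-++ p (map (λ v → xpow v 8) (allVecs m)) _)
  (cong₂ _+_ (count-map p (λ v → xpow v 8) (allVecs m))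
  (trans (count-++ p (14 ·ₚ cosetSum m 1 4) _)
  (cong₂ _+_ (count-concat-replicate p 14 (cosetSum m 1 4))
  (trans (count-++ p (168 ·ₚ cosetSum m 2 2) _)
  (cong₂ _+_ (count-concat-replicate p 168 (cosetSum m 2 2)) (count-concat-replicate p 1344 (cosetSum m 3 1)))))))
  where
  p : Monomial m → Bool
  p = _==ᵐ e

rhsCount-vanishes : (e : Monomial m) → codewordCount e ≡ 0 → ∀ κ → rhsCount κ e ≡ 0
rhsCount-vanishes e none κ = decidable-stable (rhsCount κ e ℕ.≟ 0) λ c≢0 →
  weight≢0 κ (trans (sym (codewordCount-rank κ (rhsCount≢0 κ e c≢0))) none)

rhsCount-other : (e : Monomial m) {κ : Rank} → IsCosetMonomial (dim κ) (multiplicity κ) e →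
                 ∀ κ′ → κ′ ≢ κ → rhsCount κ′ e ≡ 0
rhsCount-other e E κ′ κ′≢κ = decidable-stable (rhsCount κ′ e ℕ.≟ 0) λ c≢0 →
  κ′≢κ (multiplicity-injective (isCosetMonomial-multiplicity (rhsCount≢0 κ′ e c≢0) E (multiplicity≢0 κ′)))

codewordCount≡rhs : (e : Monomial m) → codewordCount e ≡ weightedSum (λ κ → rhsCount κ e)
codewordCount≡rhs e = by-cases (codewordCount e ℕ.≟ 0)
  where
  by-cases : Dec (codewordCount e ≡ 0) → codewordCount e ≡ weightedSum (λ κ → rhsCount κ e)
  by-cases (yes none) = trans none (sym (weightedSum-zero _ (rhsCount-vanishes e none)))
  by-cases (no some)  = let κ , E = codewordCount≢0 e some in
    trans (codewordCount-rank κ E)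
          (sym (weightedSum-single _ κ (rhsCount-isCosetMonomial κ e E) (rhsCount-other e E)))

theorem4p14 : (m : ℕ) → 1 ≤ m → (e : Monomial m) →
    coeff e (cwe-H8 m) ≡ coeff e (rhs m)
theorem4p14 m _ e = begin
  coeff e (cwe-H8 m)                   ≡⟨ coeff-cwe e ⟩
  codewordCount e                      ≡⟨ codewordCount≡rhs e ⟩
  weightedSum (λ κ → rhsCount κ e)     ≡⟨ coeff-rhs e ⟨
  coeff e (rhs m)                      ∎
  where open ≡-Reasoning
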